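{- Let $k\ge2$ and suppose that $\mathbf{L}$ has a near unanimity term of arity $k+1$. Then every finite $k$-ary $\mathbf{L}$-constrained space with the $k(k-1)$-ary local extension property has the global extension property.
   Context: An $n$-ary near unanimity term is a term $m(x_1,\dots,x_n)$ with $m^{\mathbf{L}}(a_1,\dots,a_n)=a$ whenever $a_i=a$ for all but at most one $i$. $\mathbf{L}$ is topologically discrete. $I\subseteq_kX$ means $I\subseteq X$, $|I|\le k$; $\pi_J$ is restriction to $J$. A $k$-ary $\mathbf{L}$-constrained space is a topological space $X$ with subalgebras $\mathbf{A}_I\le C(I,\mathbf{L})$ (continuous maps on the subspace $I$) for $I\subseteq_kX$, subdirect ($\mathbf{A}_J=\pi_J[\mathbf{A}_I]$ for $J\subseteq I\subseteq_kX$) and continuous (for each $\langle a_1,\dots,a_k\rangle\in\mathbf{L}^k$, the set of $\langle x_1,\dots,x_k\rangle\in X^k$ such that $x_i\mapsto a_i$ is a well-defined function belonging to $\mathbf{A}_{\{x_1,\dots,x_k\}}$ is open in $X^k$). A function $f\colon J\to\mathbf{L}$ ($J\subseteq X$) is compatible if $f|_I\in\mathbf{A}_I$ for all $I\subseteq_kJ$. The $n$-ary local extension property: for all $I\subseteq_nX$, $j\in X$ and continuous compatible $g\colon I\to\mathbf{L}$ there is a continuous compatible $f\colon I\cup\{j\}\to\mathbf{L}$ with $f|_I=g$. The global extension property: for every $I\subseteq_kX$ and $g\in\mathbf{A}_I$ there is a continuous compatible $f\colon X\to\mathbf{L}$ with $f|_I=g$. -}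

module Defs where

open import Level using (0ℓ)
open import Data.Nat using (ℕ; zero; suc; _≤_; _*_; _∸_)
open import Data.Fin using (Fin; zero; suc)
open import Data.Fin.Subset using (Subset; _∈_; _⊆_; ⁅_⁆; _∪_; _∩_; ∣_∣)
  renaming (⊥ to ∅; ⊤ to Full)
open import Data.Product using (Σ; ∃; _×_; _,_)
open import Function using (_∘_)
open import Data.Sum using (inj₁)
open import Data.Fin.Subset.Properties using (x∈p∪q⁺; ∈⊤)
open import Function.Bundles using (_⇔_)
open import Relation.Binary.PropositionalEquality using (_≡_; _≢_)

record Signature : Set₁ where
  field
    Op    : Set
    arity : Op → ℕ

record Algebra (σ : Signature) : Set₁ where
  open Signature σ
  field
    Carrier : Set
    ⟦_⟧     : (o : Op) → (Fin (arity o) → Carrier) → Carrier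

data Term (σ : Signature) (n : ℕ) : Set where
  var : Fin n → Term σ n
  op  : (o : Signature.Op σ) → (Fin (Signature.arity σ o) → Term σ n) → Term σ n

eval : ∀ {σ n} (𝐋 : Algebra σ) → Term σ n → (Fin n → Algebra.Carrier 𝐋) → Algebra.Carrier 𝐋
eval 𝐋 (var i)   ρ = ρ i
eval 𝐋 (op o ts) ρ = Algebra.⟦_⟧ 𝐋 o (λ i → eval 𝐋 (ts i) ρ)

IsNUTerm : ∀ {σ n} (𝐋 : Algebra σ) → Term σ n → Set
IsNUTerm {n = n} 𝐋 m =
  ∀ (a : Algebra.Carrier 𝐋) (i : Fin n) (as : Fin n → Algebra.Carrier 𝐋) →
    (∀ j → j ≢ i → as j ≡ a) → eval 𝐋 m as ≡ a

HasNUTerm : ∀ {σ} (𝐋 : Algebra σ) → ℕ → Set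
HasNUTerm {σ} 𝐋 n = Σ (Term σ n) (IsNUTerm 𝐋)

-- Finite topological spaces: carrier Fin N, open sets as subsets.
-- (For a finite carrier, closure under binary unions is closure under
-- arbitrary unions.)

record FiniteTopology (N : ℕ) : Set₁ where
  field
    Open  : Subset N → Set
    open-∅ : Open ∅
    open-X : Open Full
    open-∪ : ∀ {U V} → Open U → Open V → Open (U ∪ V)
    open-∩ : ∀ {U V} → Open U → Open V → Open (U ∩ V)

-- Open sets of the product space X^k (product topology: every point of
-- the set has an open box neighbourhood inside the set).
OpenInPower : ∀ {N} → FiniteTopology N → (k : ℕ) → ((Fin k → Fin N) → Set) → Set
OpenInPower {N} τ k S =
  ∀ x → S x →
    Σ (Fin k → Subset N) λ U →
      (∀ i → FiniteTopology.Open τ (U i)) × (∀ i → x i ∈ U i) ×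
      (∀ y → (∀ i → y i ∈ U i) → S y)

Fun : ∀ {N : ℕ} → Subset N → Set → Set
Fun {N} I L = (x : Fin N) → x ∈ I → L

restrict : ∀ {N L} {J I : Subset N} → J ⊆ I → Fun I L → Fun J L
restrict J⊆I f x p = f x (J⊆I p)

-- continuity of f : I → L, I with the subspace topology, L discrete:
-- the preimage of every subset S of L is open in the subspace I.
Continuous : ∀ {N} → FiniteTopology N → {L : Set} (I : Subset N) → Fun I L → Set₁
Continuous {N} τ {L} I f =
  ∀ (S : L → Set) → Σ (Subset N) λ U → FiniteTopology.Open τ U ×
    (∀ x (p : x ∈ I) → (S (f x p) ⇔ (x ∈ U)))

img : ∀ {N k} → (Fin k → Fin N) → Subset N
img {k = zero}  x = ∅
img {k = suc k} x = ⁅ x zero ⁆ ∪ img (x ∘ suc)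

-- k-ary 𝐋-constrained spaces (finite carrier Fin N).
-- 𝐀 I is only constrained for ∣ I ∣ ≤ k; its values on larger I are
-- never used.

module _ {σ : Signature} (𝐋 : Algebra σ) where
  open Signature σ
  open Algebra 𝐋

  record ConstrainedSpace (k N : ℕ) : Set₁ where
    field
      τ : FiniteTopology N
      𝐀 : (I : Subset N) → Fun I Carrier → Set
      𝐀-cont : ∀ I → ∣ I ∣ ≤ k → ∀ f → 𝐀 I f → Continuous τ I f
      𝐀-closed : ∀ I → ∣ I ∣ ≤ k → (o : Op) (fs : Fin (arity o) → Fun I Carrier) →
                 (∀ i → 𝐀 I (fs i)) → 𝐀 I (λ x p → ⟦ o ⟧ (λ i → fs i x p))
      subdirect : ∀ J I (J⊆I : J ⊆ I) → ∣ I ∣ ≤ k → (g : Fun J Carrier) →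
                  𝐀 J g ⇔ (Σ (Fun I Carrier) λ f → 𝐀 I f ×
                            (∀ x (p : x ∈ J) → restrict J⊆I f x p ≡ g x p))
      continuous : ∀ (a : Fin k → Carrier) → OpenInPower τ k λ x →
                   (∀ i j → x i ≡ x j → a i ≡ a j) ×
                   (Σ (Fun (img x) Carrier) λ g → 𝐀 (img x) g ×
                      (∀ i (p : x i ∈ img x) → g (x i) p ≡ a i))

  module _ {k N : ℕ} (𝒳 : ConstrainedSpace k N) where
    open ConstrainedSpace 𝒳

    Compatible : (J : Subset N) → Fun J Carrier → Set
    Compatible J f = ∀ I (I⊆J : I ⊆ J) → ∣ I ∣ ≤ k → 𝐀 I (restrict I⊆J f)

    LocalExtensionProperty : ℕ → Set₁
    LocalExtensionProperty n =
      ∀ (I : Subset N) → ∣ I ∣ ≤ n → (j : Fin N) (g : Fun I Carrier) →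
        Continuous τ I g → Compatible I g →
        Σ (Fun (I ∪ ⁅ j ⁆) Carrier) λ f →
          Continuous τ (I ∪ ⁅ j ⁆) f × Compatible (I ∪ ⁅ j ⁆) f ×
          (∀ x (p : x ∈ I) → f x (x∈p∪q⁺ (inj₁ p)) ≡ g x p)

    GlobalExtensionProperty : Set₁
    GlobalExtensionProperty =
      ∀ (I : Subset N) → ∣ I ∣ ≤ k → (g : Fun I Carrier) → 𝐀 I g →
        Σ (Fun Full Carrier) λ f →
          Continuous τ Full f × Compatible Full f ×
          (∀ x (p : x ∈ I) → f x ∈⊤ ≡ g x p)

-- Extend g one point at a time.  A value a for a new point j must make
-- f ∪ {j ↦ a} lie in 𝐀_K for every K ⊆ J ∪ {j} with j ∈ K and |K| ≤ k.  Any k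
-- of these constraints involve at most k(k-1) points of J, so the local
-- extension property meets them simultaneously; the (k+1)-ary near unanimity
-- term turns this into a Helly property, so all of them are met at once.
-- Continuity of the extension is read off from its restrictions to the pairs
-- {x, j}, which lie in 𝐀 and hence are continuous (this is where k ≥ 2 enters).

module Submission where

open import Defs
open import Data.Nat using (ℕ; zero; suc; _≤_; _+_; _*_; _∸_; z≤n; s≤s; _≤?_)
import Data.Nat.Properties as ℕ
open import Data.Fin using (Fin; zero; suc; inject≤; punchIn; punchOut; _≟_)
import Data.Fin.Properties as Fin
open import Data.Fin.Subset
  using (Subset; _∈_; _∉_; _⊆_; ⁅_⁆; _∪_; _∩_; ∣_∣; _-_; ⋃; ⋂; inside; outside)
  renaming (⊥ to ∅; ⊤ to Full)
open import Data.Fin.Subset.Properties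
  using ( x∈p∪q⁺; x∈p∪q⁻; x∈p∩q⁺; x∈p∩q⁻; ∈⊤; ∉⊥; _∈?_; x∈⁅x⁆; x∈⁅y⁆⇒x≡y; ∣⁅x⁆∣≡1
        ; ∣⊥∣≡0; p⊆q⇒∣p∣≤∣q∣; x∈p⇒∣p-x∣<∣p∣; x∈p∧x≢y⇒x∈p-y; p⊆p∪q; q⊆p∪q; p∩q⊆q)
import Data.Vec as Vec
open import Data.Vec.Properties.WithK using ([]=-irrelevant)
open import Data.List using (List; []; _∷_; _++_; map; length; tabulate; allFin; lookup)
open import Data.List.Properties using (length-tabulate)
open import Data.List.Relation.Unary.All as All using (All; []; _∷_)
open import Data.List.Relation.Unary.Any using (Any; here; there; index)
import Data.List.Relation.Unary.All.Properties as All
import Data.List.Relation.Unary.Any.Properties as Any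
open import Data.List.Membership.Propositional using () renaming (_∈_ to _∈ₗ_)
open import Data.List.Membership.Propositional.Properties using (∈-++⁺ˡ; ∈-++⁺ʳ; ∈-map⁺; ∈-allFin)
open import Data.Product using (Σ; ∃; _×_; _,_; proj₁; proj₂)
open import Data.Sum using (inj₁; inj₂)
open import Function using (_∘_)
open import Function.Bundles using (_⇔_; mk⇔; Equivalence)
open import Relation.Nullary using (Dec; yes; no; contradiction; _×-dec_)
open import Relation.Binary.PropositionalEquality
  using (_≡_; _≢_; refl; sym; trans; cong; cong₂; subst)

open Equivalence using (to; from)

∣p∪q∣≤∣p∣+∣q∣ : ∀ {n} (p q : Subset n) → ∣ p ∪ q ∣ ≤ ∣ p ∣ + ∣ q ∣
∣p∪q∣≤∣p∣+∣q∣ Vec.[] Vec.[] = z≤n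
∣p∪q∣≤∣p∣+∣q∣ (outside Vec.∷ p) (outside Vec.∷ q) = ∣p∪q∣≤∣p∣+∣q∣ p q
∣p∪q∣≤∣p∣+∣q∣ (outside Vec.∷ p) (inside Vec.∷ q) =
  ℕ.≤-trans (s≤s (∣p∪q∣≤∣p∣+∣q∣ p q)) (ℕ.≤-reflexive (sym (ℕ.+-suc ∣ p ∣ ∣ q ∣)))
∣p∪q∣≤∣p∣+∣q∣ (inside Vec.∷ p) (outside Vec.∷ q) = s≤s (∣p∪q∣≤∣p∣+∣q∣ p q)
∣p∪q∣≤∣p∣+∣q∣ (inside Vec.∷ p) (inside Vec.∷ q) =
  s≤s (ℕ.≤-trans (∣p∪q∣≤∣p∣+∣q∣ p q) (ℕ.+-monoʳ-≤ ∣ p ∣ (ℕ.n≤1+n _)))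

module _ {n : ℕ} where

  ∈-irrelevant : ∀ {x : Fin n} {p : Subset n} (u v : x ∈ p) → u ≡ v
  ∈-irrelevant = []=-irrelevant

  Fun-irrelevant : ∀ {L} {I : Subset n} (f : Fun I L) {x} (u v : x ∈ I) → f x u ≡ f x v
  Fun-irrelevant f u v = cong (f _) (∈-irrelevant u v)

  ∣⁅x⁆∪⁅y⁆∣≤2 : ∀ (x y : Fin n) → ∣ ⁅ x ⁆ ∪ ⁅ y ⁆ ∣ ≤ 2
  ∣⁅x⁆∪⁅y⁆∣≤2 x y = ℕ.≤-trans (∣p∪q∣≤∣p∣+∣q∣ ⁅ x ⁆ ⁅ y ⁆)
                               (ℕ.≤-reflexive (cong₂ _+_ (∣⁅x⁆∣≡1 x) (∣⁅x⁆∣≡1 y)))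

  ∣⁅x⁆∣≤1 : ∀ (x : Fin n) → ∣ ⁅ x ⁆ ∣ ≤ 1
  ∣⁅x⁆∣≤1 x = ℕ.≤-reflexive (∣⁅x⁆∣≡1 x)

  x∈⋃⁺ : ∀ {x} {ps : List (Subset n)} → Any (x ∈_) ps → x ∈ ⋃ ps
  x∈⋃⁺ (here x∈p)    = x∈p∪q⁺ (inj₁ x∈p)
  x∈⋃⁺ (there x∈ps) = x∈p∪q⁺ (inj₂ (x∈⋃⁺ x∈ps))

  x∈⋃⁻ : ∀ {x} (ps : List (Subset n)) → x ∈ ⋃ ps → Any (x ∈_) ps
  x∈⋃⁻ []       x∈∅ = contradiction x∈∅ ∉⊥
  x∈⋃⁻ (p ∷ ps) x∈ with x∈p∪q⁻ p (⋃ ps) x∈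
  ... | inj₁ x∈p   = here x∈p
  ... | inj₂ x∈⋃ps = there (x∈⋃⁻ ps x∈⋃ps)

  x∈⋂⁺ : ∀ {x} {ps : List (Subset n)} → All (x ∈_) ps → x ∈ ⋂ ps
  x∈⋂⁺ []           = ∈⊤
  x∈⋂⁺ (x∈p ∷ x∈ps) = x∈p∩q⁺ (x∈p , x∈⋂⁺ x∈ps)

  x∈⋂⁻ : ∀ {x} (ps : List (Subset n)) → x ∈ ⋂ ps → All (x ∈_) ps
  x∈⋂⁻ []       _  = []
  x∈⋂⁻ (p ∷ ps) x∈ = proj₁ (x∈p∩q⁻ p _ x∈) ∷ x∈⋂⁻ ps (proj₂ (x∈p∩q⁻ p _ x∈))

  ∣⋃∣≤ : ∀ {c} {ps : List (Subset n)} → All (λ p → ∣ p ∣ ≤ c) ps → ∣ ⋃ ps ∣ ≤ length ps * c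
  ∣⋃∣≤ []                     = ℕ.≤-reflexive (∣⊥∣≡0 n)
  ∣⋃∣≤ {ps = p ∷ ps} (b ∷ bs) = ℕ.≤-trans (∣p∪q∣≤∣p∣+∣q∣ p (⋃ ps)) (ℕ.+-mono-≤ b (∣⋃∣≤ bs))

  ∈-∪⁅⁆-≢ : ∀ {J : Subset n} {j x} → x ∈ J ∪ ⁅ j ⁆ → x ≢ j → x ∈ J
  ∈-∪⁅⁆-≢ {J} {j} x∈ x≢j with x∈p∪q⁻ J ⁅ j ⁆ x∈
  ... | inj₁ x∈J = x∈J
  ... | inj₂ x∈j = contradiction (x∈⁅y⁆⇒x≡y j x∈j) x≢j

  ⁅x⁆∪⁅j⁆⊆ : ∀ {J : Subset n} {j x} → x ∈ J ∪ ⁅ j ⁆ → ⁅ x ⁆ ∪ ⁅ j ⁆ ⊆ J ∪ ⁅ j ⁆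
  ⁅x⁆∪⁅j⁆⊆ {J} {j} {x} x∈ y∈ with x∈p∪q⁻ ⁅ x ⁆ ⁅ j ⁆ y∈
  ... | inj₂ y∈j = x∈p∪q⁺ (inj₂ y∈j)
  ... | inj₁ y∈x with x∈⁅y⁆⇒x≡y x y∈x
  ... | refl = x∈

subsets : ∀ n → List (Subset n)
subsets zero    = Vec.[] ∷ []
subsets (suc n) = map (inside Vec.∷_) (subsets n) ++ map (outside Vec.∷_) (subsets n)

∈-subsets : ∀ {n} (p : Subset n) → p ∈ₗ subsets n
∈-subsets Vec.[]                   = here refl
∈-subsets {suc n} (inside Vec.∷ p)  = ∈-++⁺ˡ (∈-map⁺ (inside Vec.∷_) (∈-subsets p))
∈-subsets {suc n} (outside Vec.∷ p) =
  ∈-++⁺ʳ (map (inside Vec.∷_) (subsets n)) (∈-map⁺ (outside Vec.∷_) (∈-subsets p))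

module _ {n : ℕ} {L : Set} {J : Subset n} (j : Fin n) (f : Fun J L) where

  extend : L → Fun (J ∪ ⁅ j ⁆) L
  extend a x x∈ with x ≟ j
  ... | yes _   = a
  ... | no x≢j = f x (∈-∪⁅⁆-≢ x∈ x≢j)

  extend-≡ : ∀ a (j∈ : j ∈ J ∪ ⁅ j ⁆) → extend a j j∈ ≡ a
  extend-≡ a j∈ with j ≟ j
  ... | yes _   = refl
  ... | no j≢j = contradiction refl j≢j

  extend-≢ : ∀ a {x} (x∈J : x ∈ J) (x∈ : x ∈ J ∪ ⁅ j ⁆) → x ≢ j → extend a x x∈ ≡ f x x∈J
  extend-≢ a {x} x∈J x∈ x≢j with x ≟ j
  ... | yes x≡j = contradiction x≡j x≢j
  ... | no _    = Fun-irrelevant f _ _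

module _ {N : ℕ} (τ : FiniteTopology N) where
  open FiniteTopology τ

  Open-⋃ : ∀ {ps : List (Subset N)} → All Open ps → Open (⋃ ps)
  Open-⋃ []       = open-∅
  Open-⋃ (U ∷ Us) = open-∪ U (Open-⋃ Us)

  Open-⋂ : ∀ {ps : List (Subset N)} → All Open ps → Open (⋂ ps)
  Open-⋂ []       = open-X
  Open-⋂ (U ∷ Us) = open-∩ U (Open-⋂ Us)

  continuous-restrict : ∀ {L} {J I : Subset N} (J⊆I : J ⊆ I) {f : Fun I L} {g : Fun J L} →
                        (∀ x (x∈ : x ∈ J) → f x (J⊆I x∈) ≡ g x x∈) →
                        Continuous τ I f → Continuous τ J g
  continuous-restrict J⊆I f≡g f-cont S with f-cont S
  ... | U , open-U , S∘f⇔U =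
    U , open-U , λ x x∈ → subst (λ b → S b ⇔ (x ∈ U)) (f≡g x x∈) (S∘f⇔U x (J⊆I x∈))

  -- Each pair {x, j} yields an open set W x recording S both at x and at j;
  -- then U = (U_J ∪ ⋂ W) ∩ ⋃ W is the preimage of S, without deciding S (f j).
  continuous-∪⁅⁆ : ∀ {L} {J : Subset N} (j : Fin N) (f : Fun (J ∪ ⁅ j ⁆) L) →
                   Continuous τ J (restrict (p⊆p∪q ⁅ j ⁆) f) →
                   (∀ x (x∈ : x ∈ J ∪ ⁅ j ⁆) →
                      Continuous τ (⁅ x ⁆ ∪ ⁅ j ⁆) (restrict (⁅x⁆∪⁅j⁆⊆ x∈) f)) →
                   Continuous τ (J ∪ ⁅ j ⁆) f
  continuous-∪⁅⁆ {L} {J} j f J-cont pair-cont S = U , open-U , S∘f⇔U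
    where
    J⁺ = J ∪ ⁅ j ⁆

    j∈J⁺ : j ∈ J⁺
    j∈J⁺ = x∈p∪q⁺ (inj₂ (x∈⁅x⁆ j))

    S-irr : ∀ {x} (u v : x ∈ J⁺) → S (f x u) → S (f x v)
    S-irr u v = subst S (Fun-irrelevant f u v)

    PairNbhd : Fin N → Set
    PairNbhd x = Σ (Subset N) λ W → Open W ×
                   (S (f j j∈J⁺) ⇔ (j ∈ W)) × (∀ (x∈ : x ∈ J⁺) → S (f x x∈) ⇔ (x ∈ W))

    pairNbhd-∈ : ∀ x → x ∈ J⁺ → PairNbhd x
    pairNbhd-∈ x x∈ with pair-cont x x∈ S
    ... | W , open-W , S⇔W = W , open-W , at j∈⁅x⁆∪⁅j⁆ , λ _ → at x∈⁅x⁆∪⁅j⁆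
      where
      at : ∀ {y} (y∈ : y ∈ ⁅ x ⁆ ∪ ⁅ j ⁆) {u : y ∈ J⁺} → S (f y u) ⇔ (y ∈ W)
      at y∈ = subst (λ b → S b ⇔ (_ ∈ W)) (Fun-irrelevant f _ _) (S⇔W _ y∈)
      j∈⁅x⁆∪⁅j⁆ = x∈p∪q⁺ (inj₂ (x∈⁅x⁆ j))
      x∈⁅x⁆∪⁅j⁆ = x∈p∪q⁺ (inj₁ (x∈⁅x⁆ x))

    pairNbhd : ∀ x → Dec (x ∈ J⁺) → PairNbhd x
    pairNbhd x (yes x∈) = pairNbhd-∈ x x∈
    pairNbhd x (no x∉)  with pairNbhd-∈ j j∈J⁺
    ... | W , open-W , at-j , _ = W , open-W , at-j , λ x∈ → contradiction x∈ x∉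

    W : Fin N → Subset N
    W x = proj₁ (pairNbhd x (x ∈? J⁺))

    W-open : ∀ x → Open (W x)
    W-open x = proj₁ (proj₂ (pairNbhd x (x ∈? J⁺)))

    W-at-j : ∀ x → S (f j j∈J⁺) ⇔ (j ∈ W x)
    W-at-j x = proj₁ (proj₂ (proj₂ (pairNbhd x (x ∈? J⁺))))

    W-at-x : ∀ x (x∈ : x ∈ J⁺) → S (f x x∈) ⇔ (x ∈ W x)
    W-at-x x = proj₂ (proj₂ (proj₂ (pairNbhd x (x ∈? J⁺))))

    Ws = tabulate W
    UJ = proj₁ (J-cont S)
    S⇔UJ = proj₂ (proj₂ (J-cont S))
    U = (UJ ∪ ⋂ Ws) ∩ ⋃ Ws

    open-U : Open U
    open-U = open-∩ (open-∪ (proj₁ (proj₂ (J-cont S))) (Open-⋂ (All.tabulate⁺ W-open)))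
                    (Open-⋃ (All.tabulate⁺ W-open))

    on-J : ∀ x (x∈J : x ∈ J) (x∈ : x ∈ J⁺) → S (f x x∈) ⇔ (x ∈ U)
    on-J x x∈J x∈ = mk⇔
      (λ s → x∈p∩q⁺ ( x∈p∪q⁺ (inj₁ (to (S⇔UJ x x∈J) (S-irr _ _ s)))
                    , x∈⋃⁺ (Any.tabulate⁺ x (to (W-at-x x x∈) s))))
      (λ x∈U → case-∪ (proj₁ (x∈p∩q⁻ _ (⋃ Ws) x∈U)))
      where
      case-∪ : x ∈ UJ ∪ ⋂ Ws → S (f x x∈)
      case-∪ x∈∪ with x∈p∪q⁻ UJ (⋂ Ws) x∈∪
      ... | inj₁ x∈UJ = S-irr _ _ (from (S⇔UJ x x∈J) x∈UJ)
      ... | inj₂ x∈⋂  = from (W-at-x x x∈) (All.tabulate⁻ (x∈⋂⁻ Ws x∈⋂) x)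

    at-j : S (f j j∈J⁺) ⇔ (j ∈ U)
    at-j = mk⇔
      (λ s → x∈p∩q⁺ ( x∈p∪q⁺ (inj₂ (x∈⋂⁺ (All.tabulate⁺ λ x → to (W-at-j x) s)))
                    , x∈⋃⁺ (Any.tabulate⁺ j (to (W-at-j j) s))))
      (λ j∈U → let (x , j∈Wx) = Any.tabulate⁻ (x∈⋃⁻ Ws (proj₂ (x∈p∩q⁻ _ (⋃ Ws) j∈U)))
               in from (W-at-j x) j∈Wx)

    S∘f⇔U : ∀ x (x∈ : x ∈ J⁺) → S (f x x∈) ⇔ (x ∈ U)
    S∘f⇔U x x∈ with x∈p∪q⁻ J ⁅ j ⁆ x∈
    ... | inj₁ x∈J = on-J x x∈J x∈
    ... | inj₂ x∈j with x∈⁅y⁆⇒x≡y j x∈j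
    ... | refl = subst (λ b → S b ⇔ (j ∈ U)) (Fun-irrelevant f _ _) at-j

injective⇒atMostOnePreimage : ∀ {m n} (ι : Fin (suc m) → Fin n) →
                              (∀ {t t′} → ι t ≡ ι t′ → t ≡ t′) →
                              ∀ s → ∃ λ e → ∀ t → t ≢ e → ι t ≢ s
injective⇒atMostOnePreimage ι ι-inj s with Fin.any? (λ t → ι t ≟ s)
... | yes (e , ιe≡s) = e , λ t t≢e ιt≡s → t≢e (ι-inj (trans ιt≡s (sym ιe≡s)))
... | no ∄preimage   = zero , λ t _ ιt≡s → ∄preimage (t , ιt≡s)

-- For r > k constraints, solve the r - 1 remaining ones after dropping each of
-- the first k+1 in turn, and combine the k+1 solutions with μ: every
-- constraint was dropped at most once, so it is met by all arguments but one.
module Helly {A T : Set} {k : ℕ} (μ : (Fin (suc k) → A) → A)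
             (P : A → Set) (B : T → A → Set)
             (P-closed : ∀ as → (∀ t → P (as t)) → P (μ as))
             (B-almostClosed : ∀ c as → (∀ t → P (as t)) →
                               ∀ e → (∀ t → t ≢ e → B c (as t)) → B c (μ as))
  where

  Solvable : ∀ {r} → (Fin r → T) → Set
  Solvable cs = ∃ λ a → P a × ∀ s → B (cs s) a

  helly : (∀ {r} → r ≤ k → (cs : Fin r → T) → Solvable cs) →
          ∀ {r} (cs : Fin r → T) → Solvable cs
  helly small {r} cs with r ≤? k
  ... | yes r≤k = small r≤k cs
  helly small {zero}  cs | no 0≰k = contradiction z≤n 0≰k
  helly small {suc r} cs | no r≰k =
    μ as , P-closed as (proj₁ ∘ proj₂ ∘ dropped) , μas-solves
    where
    k<r = ℕ.≰⇒> r≰k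

    ι : Fin (suc k) → Fin (suc r)
    ι t = inject≤ t k<r

    dropped : ∀ t → Solvable (cs ∘ punchIn (ι t))
    dropped t = helly small (cs ∘ punchIn (ι t))

    as : Fin (suc k) → A
    as t = proj₁ (dropped t)

    μas-solves : ∀ s → B (cs s) (μ as)
    μas-solves s with injective⇒atMostOnePreimage ι (Fin.inject≤-injective _ _ _ _) s
    ... | e , ι≢s = B-almostClosed (cs s) as (proj₁ ∘ proj₂ ∘ dropped) e λ t t≢e →
      subst (λ s′ → B (cs s′) (as t)) (Fin.punchIn-punchOut (ι≢s t t≢e))
            (proj₂ (proj₂ (dropped t)) (punchOut (ι≢s t t≢e)))

module _ {σ : Signature} {𝐋 : Algebra σ} {k N : ℕ} (𝒳 : ConstrainedSpace 𝐋 k N) where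
  open Algebra 𝐋 using (Carrier)
  open ConstrainedSpace 𝒳

  𝐀-resp : ∀ {K} → ∣ K ∣ ≤ k → {f g : Fun K Carrier} →
           𝐀 K f → (∀ x (x∈ : x ∈ K) → f x x∈ ≡ g x x∈) → 𝐀 K g
  𝐀-resp {K} K≤k {f} {g} f∈𝐀 f≡g = from (subdirect K K (λ x∈ → x∈) K≤k g) (f , f∈𝐀 , f≡g)

  𝐀-term : ∀ {K n} → ∣ K ∣ ≤ k → (t : Term σ n) {fs : Fin n → Fun K Carrier} →
           (∀ i → 𝐀 K (fs i)) → 𝐀 K (λ x x∈ → eval 𝐋 t (λ i → fs i x x∈))
  𝐀-term K≤k (var i)   fs∈𝐀 = fs∈𝐀 i
  𝐀-term K≤k (op o ts) fs∈𝐀 = 𝐀-closed _ K≤k o _ (λ i → 𝐀-term K≤k (ts i) fs∈𝐀)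

  𝐀⇒compatible : ∀ {I} → ∣ I ∣ ≤ k → {g : Fun I Carrier} → 𝐀 I g → Compatible 𝐋 𝒳 I g
  𝐀⇒compatible I≤k g∈𝐀 K K⊆I K≤k = from (subdirect K _ K⊆I I≤k _) (_ , g∈𝐀 , λ _ _ → refl)

  compatible-restrict : ∀ {J I} (J⊆I : J ⊆ I) {f : Fun I Carrier} →
                        Compatible 𝐋 𝒳 I f → Compatible 𝐋 𝒳 J (restrict J⊆I f)
  compatible-restrict J⊆I f-compat K K⊆J = f-compat K (λ x∈ → J⊆I (K⊆J x∈))

module OnePointExtension
  {σ : Signature} {𝐋 : Algebra σ} {k N : ℕ} (𝒳 : ConstrainedSpace 𝐋 k N) (2≤k : 2 ≤ k)
  {m : Term σ (suc k)} (m-nu : IsNUTerm 𝐋 m)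
  (lep : LocalExtensionProperty 𝐋 𝒳 (k * (k ∸ 1)))
  {J : Subset N} {j : Fin N} (j∉J : j ∉ J) {f : Fun J (Algebra.Carrier 𝐋)}
  (f-cont : Continuous (ConstrainedSpace.τ 𝒳) J f) (f-compat : Compatible 𝐋 𝒳 J f)
  where

  open Algebra 𝐋 using () renaming (Carrier to L)
  open ConstrainedSpace 𝒳

  J⁺ : Subset N
  J⁺ = J ∪ ⁅ j ⁆

  j∈J⁺ : j ∈ J⁺
  j∈J⁺ = x∈p∪q⁺ (inj₂ (x∈⁅x⁆ j))

  ∣⁅x⁆∪⁅j⁆∣≤k : ∀ x → ∣ ⁅ x ⁆ ∪ ⁅ j ⁆ ∣ ≤ k
  ∣⁅x⁆∪⁅j⁆∣≤k x = ℕ.≤-trans (∣⁅x⁆∪⁅y⁆∣≤2 x j) 2≤k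

  ∣⁅j⁆∣≤k : ∣ ⁅ j ⁆ ∣ ≤ k
  ∣⁅j⁆∣≤k = ℕ.≤-trans (∣⁅x⁆∣≤1 j) (ℕ.≤-trans (ℕ.n≤1+n 1) 2≤k)

  ext : L → Fun J⁺ L
  ext = extend j f

  ext-on-J : ∀ a {x} (x∈J : x ∈ J) (x∈ : x ∈ J⁺) → ext a x x∈ ≡ f x x∈J
  ext-on-J a x∈J x∈ = extend-≢ j f a x∈J x∈ λ { refl → j∉J x∈J }

  Admissible : L → Set
  Admissible a = 𝐀 ⁅ j ⁆ (λ _ _ → a)

  Respects : Subset N → L → Set
  Respects K a = (K⊆J⁺ : K ⊆ J⁺) → j ∈ K → ∣ K ∣ ≤ k → 𝐀 K (restrict K⊆J⁺ (ext a))

  ext-awayFrom-j : ∀ a {K} (K⊆J⁺ : K ⊆ J⁺) → j ∉ K → ∣ K ∣ ≤ k → 𝐀 K (restrict K⊆J⁺ (ext a))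
  ext-awayFrom-j a {K} K⊆J⁺ j∉K K≤k =
    𝐀-resp 𝒳 K≤k (f-compat K K⊆J K≤k) λ x x∈K → sym (ext-on-J a (K⊆J x∈K) (K⊆J⁺ x∈K))
    where
    K⊆J : K ⊆ J
    K⊆J x∈K = ∈-∪⁅⁆-≢ (K⊆J⁺ x∈K) λ { refl → j∉K x∈K }

  Admissible-closed : ∀ as → (∀ t → Admissible (as t)) → Admissible (eval 𝐋 m as)
  Admissible-closed as as-adm = 𝐀-term 𝒳 ∣⁅j⁆∣≤k m as-adm

  pin : ∀ {A : Set} → Dec A → L → L → L
  pin (yes _) a _ = a
  pin (no _)  _ b = b

  -- The e-th argument is replaced by some φ ∈ 𝐀_K with φ(j) = as e, which need
  -- not agree with f; the near unanimity term outvotes it on K ∩ J.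
  Respects-almostClosed : ∀ K as → (∀ t → Admissible (as t)) →
                      ∀ e → (∀ t → t ≢ e → Respects K (as t)) → Respects K (eval 𝐋 m as)
  Respects-almostClosed K as as-adm e good K⊆J⁺ j∈K K≤k =
    𝐀-resp 𝒳 K≤k (𝐀-term 𝒳 K≤k m pinned∈𝐀) m∘pinned≡ext
    where
    ⁅j⁆⊆K : ⁅ j ⁆ ⊆ K
    ⁅j⁆⊆K x∈⁅j⁆ with x∈⁅y⁆⇒x≡y j x∈⁅j⁆
    ... | refl = j∈K

    φ-spec = to (subdirect ⁅ j ⁆ K ⁅j⁆⊆K K≤k (λ _ _ → as e)) (as-adm e)

    φ : Fun K L
    φ = proj₁ φ-spec

    choose : ∀ t → Dec (t ≡ e) → Fun K L
    choose t (yes _) = φ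
    choose t (no _)  = restrict K⊆J⁺ (ext (as t))

    choose∈𝐀 : ∀ t d → 𝐀 K (choose t d)
    choose∈𝐀 t (yes _)  = proj₁ (proj₂ φ-spec)
    choose∈𝐀 t (no t≢e) = good t t≢e K⊆J⁺ j∈K K≤k

    choose-at-j : ∀ t d (j∈K′ : j ∈ K) → choose t d j j∈K′ ≡ as t
    choose-at-j t (yes refl) j∈K′ = trans (Fun-irrelevant φ _ _) (proj₂ (proj₂ φ-spec) j (x∈⁅x⁆ j))
    choose-at-j t (no _)     j∈K′ = extend-≡ j f (as t) (K⊆J⁺ j∈K′)

    choose-on-J : ∀ t d {x} (x∈J : x ∈ J) (x∈K : x ∈ K) → t ≢ e → choose t d x x∈K ≡ f x x∈J
    choose-on-J t (yes t≡e) x∈J x∈K t≢e = contradiction t≡e t≢e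
    choose-on-J t (no _)    x∈J x∈K t≢e = ext-on-J (as t) x∈J (K⊆J⁺ x∈K)

    -- Pinning the value at j makes the j-th coordinate of the term application
    -- literally eval m as; without function extensionality eval cannot be
    -- rewritten pointwise.
    pinned : Fin (suc k) → Fun K L
    pinned t x x∈K = pin (x ≟ j) (as t) (choose t (t ≟ e) x x∈K)

    pinned∈𝐀 : ∀ t → 𝐀 K (pinned t)
    pinned∈𝐀 t = 𝐀-resp 𝒳 K≤k (choose∈𝐀 t (t ≟ e)) λ x x∈K → unpinned x x∈K (x ≟ j)
      where
      unpinned : ∀ x x∈K d → choose t (t ≟ e) x x∈K ≡ pin d (as t) (choose t (t ≟ e) x x∈K)
      unpinned x x∈K (yes refl) = choose-at-j t (t ≟ e) x∈K
      unpinned x x∈K (no _)     = refl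

    m∘pinned≡ext : ∀ x (x∈K : x ∈ K) →
                   eval 𝐋 m (λ t → pinned t x x∈K) ≡ ext (eval 𝐋 m as) x (K⊆J⁺ x∈K)
    m∘pinned≡ext x x∈K with x ≟ j
    ... | yes _   = refl
    ... | no x≢j = m-nu (f x x∈J) e _ λ t t≢e → choose-on-J t (t ≟ e) x∈J x∈K t≢e
      where
      x∈J = ∈-∪⁅⁆-≢ (K⊆J⁺ x∈K) x≢j

  open Helly (eval 𝐋 m) Admissible Respects Admissible-closed Respects-almostClosed

  Respects-fromLocal : ∀ {D} (D⊆J : D ⊆ J) (h : Fun (D ∪ ⁅ j ⁆) L) →
                       Compatible 𝐋 𝒳 (D ∪ ⁅ j ⁆) h →
                       (∀ x (x∈D : x ∈ D) → h x (x∈p∪q⁺ (inj₁ x∈D)) ≡ f x (D⊆J x∈D)) →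
                       ∀ K → K ∩ J ⊆ D → Respects K (h j (x∈p∪q⁺ (inj₂ (x∈⁅x⁆ j))))
  Respects-fromLocal {D} D⊆J h h-compat h≡f K K∩J⊆D K⊆J⁺ _ K≤k =
    𝐀-resp 𝒳 K≤k (h-compat K K⊆D⁺ K≤k) h≡ext
    where
    K⊆D⁺ : K ⊆ D ∪ ⁅ j ⁆
    K⊆D⁺ x∈K with x∈p∪q⁻ J ⁅ j ⁆ (K⊆J⁺ x∈K)
    ... | inj₁ x∈J = x∈p∪q⁺ (inj₁ (K∩J⊆D (x∈p∩q⁺ (x∈K , x∈J))))
    ... | inj₂ x∈j = x∈p∪q⁺ (inj₂ x∈j)

    h≡ext : ∀ x (x∈K : x ∈ K) →
            h x (K⊆D⁺ x∈K) ≡ ext (h j (x∈p∪q⁺ (inj₂ (x∈⁅x⁆ j)))) x (K⊆J⁺ x∈K)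
    h≡ext x x∈K with x∈p∪q⁻ J ⁅ j ⁆ (K⊆J⁺ x∈K)
    ... | inj₁ x∈J = trans (trans (Fun-irrelevant h _ _) (h≡f x x∈D))
                           (sym (ext-on-J _ (D⊆J x∈D) (K⊆J⁺ x∈K)))
      where
      x∈D = K∩J⊆D (x∈p∩q⁺ (x∈K , x∈J))
    ... | inj₂ x∈j with x∈⁅y⁆⇒x≡y j x∈j
    ... | refl = trans (Fun-irrelevant h _ _) (sym (extend-≡ j f _ (K⊆J⁺ x∈K)))

  Relevant : Subset N → Set
  Relevant K = j ∈ K × ∣ K ∣ ≤ k

  relevant? : ∀ K → Dec (Relevant K)
  relevant? K = (j ∈? K) ×-dec (∣ K ∣ ≤? k)

  relevantPart : ∀ K → Dec (Relevant K) → Subset N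
  relevantPart K (yes _) = K ∩ J
  relevantPart K (no _)  = ∅

  relevantPart⊆J : ∀ K d → relevantPart K d ⊆ J
  relevantPart⊆J K (yes _) = p∩q⊆q K J
  relevantPart⊆J K (no _)  = λ x∈∅ → contradiction x∈∅ ∉⊥

  relevantPart-covers : ∀ K d → Relevant K → K ∩ J ⊆ relevantPart K d
  relevantPart-covers K (yes _)          _   = λ x∈ → x∈
  relevantPart-covers K (no ¬relevant) rel = contradiction rel ¬relevant

  ∣relevantPart∣≤k∸1 : ∀ K d → ∣ relevantPart K d ∣ ≤ k ∸ 1
  ∣relevantPart∣≤k∸1 K (no _)            = ℕ.≤-trans (ℕ.≤-reflexive (∣⊥∣≡0 N)) z≤n
  ∣relevantPart∣≤k∸1 K (yes (j∈K , K≤k)) =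
    ℕ.≤-trans (ℕ.suc[m]≤n⇒m≤pred[n] ∣K∩J∣<k) (ℕ.≤-reflexive (ℕ.pred[m∸n]≡m∸[1+n] k 0))
    where
    K∩J⊆K-j : K ∩ J ⊆ K - j
    K∩J⊆K-j x∈ with x∈p∩q⁻ K J x∈
    ... | x∈K , x∈J = x∈p∧x≢y⇒x∈p-y x∈K λ { refl → j∉J x∈J }

    ∣K∩J∣<k = ℕ.<-≤-trans (ℕ.≤-<-trans (p⊆q⇒∣p∣≤∣q∣ K∩J⊆K-j) (x∈p⇒∣p-x∣<∣p∣ j∈K)) K≤k

  -- Up to k constraints meet J in at most k(k-1) points, which the local
  -- extension property handles at once.
  solvable-≤k : ∀ {r} → r ≤ k → (cs : Fin r → Subset N) → Solvable cs
  solvable-≤k {r} r≤k cs = h j j∈D⁺ , a-admissible , a-respects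
    where
    part : Fin r → Subset N
    part s = relevantPart (cs s) (relevant? (cs s))

    D : Subset N
    D = ⋃ (tabulate part)

    D⊆J : D ⊆ J
    D⊆J x∈D with Any.tabulate⁻ (x∈⋃⁻ (tabulate part) x∈D)
    ... | s , x∈part = relevantPart⊆J (cs s) (relevant? (cs s)) x∈part

    ∣D∣≤ : ∣ D ∣ ≤ k * (k ∸ 1)
    ∣D∣≤ = begin
      ∣ D ∣                            ≤⟨ ∣⋃∣≤ (All.tabulate⁺ λ s → ∣part∣≤ s) ⟩
      length (tabulate part) * (k ∸ 1) ≡⟨ cong (_* (k ∸ 1)) (length-tabulate part) ⟩
      r * (k ∸ 1)                      ≤⟨ ℕ.*-monoˡ-≤ (k ∸ 1) r≤k ⟩
      k * (k ∸ 1)                      ∎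
      where
      open ℕ.≤-Reasoning
      ∣part∣≤ : ∀ s → ∣ part s ∣ ≤ k ∸ 1
      ∣part∣≤ s = ∣relevantPart∣≤k∸1 (cs s) (relevant? (cs s))

    local = lep D ∣D∣≤ j (restrict D⊆J f)
                (continuous-restrict τ D⊆J {f = f} (λ _ _ → refl) f-cont)
                (compatible-restrict 𝒳 D⊆J {f = f} f-compat)

    h : Fun (D ∪ ⁅ j ⁆) L
    h = proj₁ local

    h-compat : Compatible 𝐋 𝒳 (D ∪ ⁅ j ⁆) h
    h-compat = proj₁ (proj₂ (proj₂ local))

    h≡f : ∀ x (x∈D : x ∈ D) → h x (x∈p∪q⁺ (inj₁ x∈D)) ≡ f x (D⊆J x∈D)
    h≡f = proj₂ (proj₂ (proj₂ local))

    j∈D⁺ : j ∈ D ∪ ⁅ j ⁆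
    j∈D⁺ = x∈p∪q⁺ (inj₂ (x∈⁅x⁆ j))

    a-admissible : Admissible (h j j∈D⁺)
    a-admissible = 𝐀-resp 𝒳 ∣⁅j⁆∣≤k (h-compat ⁅ j ⁆ (q⊆p∪q D ⁅ j ⁆) ∣⁅j⁆∣≤k) h≡a
      where
      h≡a : ∀ x (x∈ : x ∈ ⁅ j ⁆) → h x (q⊆p∪q D ⁅ j ⁆ x∈) ≡ h j j∈D⁺
      h≡a x x∈ with x∈⁅y⁆⇒x≡y j x∈
      ... | refl = Fun-irrelevant h _ _

    a-respects : ∀ s → Respects (cs s) (h j j∈D⁺)
    a-respects s K⊆J⁺ j∈K K≤k =
      Respects-fromLocal D⊆J h h-compat h≡f (cs s) K∩J⊆D K⊆J⁺ j∈K K≤k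
      where
      K∩J⊆D : cs s ∩ J ⊆ D
      K∩J⊆D x∈ =
        x∈⋃⁺ (Any.tabulate⁺ s (relevantPart-covers (cs s) (relevant? (cs s)) (j∈K , K≤k) x∈))

  respectsAll : ∃ λ a → ∀ K → Respects K a
  respectsAll with helly solvable-≤k (lookup (subsets N))
  ... | a , _ , respects = a , λ K →
    subst (λ K′ → Respects K′ a) (sym (Any.lookup-index (∈-subsets K)))
          (respects (index (∈-subsets K)))

  extension : ∃ λ a → Continuous τ J⁺ (ext a) × Compatible 𝐋 𝒳 J⁺ (ext a)
  extension with respectsAll
  ... | a , respects = a , ext-continuous , ext-compatible
    where
    ext-compatible : Compatible 𝐋 𝒳 J⁺ (ext a)
    ext-compatible K K⊆J⁺ K≤k with j ∈? K
    ... | yes j∈K = respects K K⊆J⁺ j∈K K≤k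
    ... | no j∉K  = ext-awayFrom-j a K⊆J⁺ j∉K K≤k

    ext-continuous : Continuous τ J⁺ (ext a)
    ext-continuous = continuous-∪⁅⁆ τ j (ext a)
      (continuous-restrict τ (λ x∈ → x∈) (λ x x∈J → sym (ext-on-J a x∈J _)) f-cont)
      λ x x∈ → 𝐀-cont _ (∣⁅x⁆∪⁅j⁆∣≤k x) _ (ext-compatible _ (⁅x⁆∪⁅j⁆⊆ x∈) (∣⁅x⁆∪⁅j⁆∣≤k x))

module GlobalExtension
  {σ : Signature} {𝐋 : Algebra σ} {k N : ℕ} (𝒳 : ConstrainedSpace 𝐋 k N) (2≤k : 2 ≤ k)
  {m : Term σ (suc k)} (m-nu : IsNUTerm 𝐋 m)
  (lep : LocalExtensionProperty 𝐋 𝒳 (k * (k ∸ 1)))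
  {I : Subset N} {g : Fun I (Algebra.Carrier 𝐋)}
  where

  open Algebra 𝐋 using () renaming (Carrier to L)
  open ConstrainedSpace 𝒳

  record Extension (J : Subset N) : Set₁ where
    field
      I⊆J    : I ⊆ J
      fun    : Fun J L
      cont   : Continuous τ J fun
      compat : Compatible 𝐋 𝒳 J fun
      agrees : ∀ x (x∈I : x ∈ I) → fun x (I⊆J x∈I) ≡ g x x∈I

  initial : ∣ I ∣ ≤ k → 𝐀 I g → Extension I
  initial I≤k g∈𝐀 = record
    { I⊆J = λ x∈ → x∈ ; fun = g ; cont = 𝐀-cont I I≤k g g∈𝐀
    ; compat = 𝐀⇒compatible 𝒳 I≤k g∈𝐀 ; agrees = λ _ _ → refl }

  grow : ∀ {J} → Extension J → ∀ j → Σ (Subset N) λ J′ → j ∈ J′ × J ⊆ J′ × Extension J′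
  grow {J} E j with j ∈? J
  ... | yes j∈J = J , j∈J , (λ x∈ → x∈) , E
  ... | no j∉J  = J ∪ ⁅ j ⁆ , x∈p∪q⁺ (inj₂ (x∈⁅x⁆ j)) , p⊆p∪q ⁅ j ⁆ , record
    { I⊆J = λ x∈I → p⊆p∪q ⁅ j ⁆ (I⊆J x∈I)
    ; fun = ext a ; cont = a-cont ; compat = a-compat
    ; agrees = λ x x∈I → trans (ext-on-J a (I⊆J x∈I) _) (agrees x x∈I) }
    where
    open Extension E
    open OnePointExtension 𝒳 2≤k {m} m-nu lep j∉J cont compat
    a = proj₁ extension
    a-cont = proj₁ (proj₂ extension)
    a-compat = proj₂ (proj₂ extension)

  growAll : ∀ {J} → Extension J → ∀ xs → Σ (Subset N) λ J′ → All (_∈ J′) xs × Extension J′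
  growAll E []       = _ , [] , E
  growAll E (x ∷ xs) with growAll E xs
  ... | J , xs⊆J , E′ with grow E′ x
  ... | J′ , x∈J′ , J⊆J′ , E″ = J′ , x∈J′ ∷ All.map J⊆J′ xs⊆J , E″

  total : ∀ {J} → Extension J → (∀ x → x ∈ J) →
          Σ (Fun Full L) λ F → Continuous τ Full F × Compatible 𝐋 𝒳 Full F ×
                               (∀ x (x∈I : x ∈ I) → F x ∈⊤ ≡ g x x∈I)
  total E X⊆J = restrict Full⊆J fun
              , continuous-restrict τ Full⊆J {f = fun} (λ _ _ → refl) cont
              , compatible-restrict 𝒳 Full⊆J {f = fun} compat
              , λ x x∈I → trans (Fun-irrelevant fun _ _) (agrees x x∈I)
    where
    open Extension E
    Full⊆J : Full ⊆ _
    Full⊆J {x} _ = X⊆J x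

mainTheorem17 : ∀ {σ : Signature} (𝐋 : Algebra σ) (k : ℕ) → 2 ≤ k →
    HasNUTerm 𝐋 (suc k) →
    ∀ {N : ℕ} (𝒳 : ConstrainedSpace 𝐋 k N) →
    LocalExtensionProperty 𝐋 𝒳 (k * (k ∸ 1)) →
    GlobalExtensionProperty 𝐋 𝒳
mainTheorem17 𝐋 k 2≤k (m , m-nu) {N} 𝒳 lep I I≤k g g∈𝐀 =
  let (_ , X⊆J , E) = growAll (initial I≤k g∈𝐀) (allFin N)
  in  total E λ x → All.lookup X⊆J (∈-allFin x)
  where open GlobalExtension 𝒳 2≤k {m} m-nu lep
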